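{- Let $\ell\geq 2$, let $G_\ell$ be the $\ell\times\ell$ grid graph and let $S$ be a resolving set of $G_\ell$. Let $\{x,y\}$ be an $S$-unique diagonal pair with associated vertex $u$ and $d(x,y)=2$. If there exist two $S$-unique diagonal pairs $\{r,s\}$, $\{t,z\}$ in the same row (respectively, in the same column) as $\{x,y\}$, with associated vertices $v$ and $w$ respectively, and $u\neq v$, $u\neq w$, then $v=w$.
   Context: $G_\ell$ has vertex set $[0,\ell-1]\times[0,\ell-1]$ (integer points), two vertices adjacent when they differ by $1$ in exactly one coordinate, so $d((x_1,x_2),(y_1,y_2))=|x_1-y_1|+|x_2-y_2|$. The diagonals are $D_i=\{x: x_1+x_2=i\}$ for $0\le i\le\ell-1$; a pair $\{x,y\}$ is a diagonal pair if $x,y\in D_i$ for some $i$, and its elements are always named so that $x<y$, i.e. $x_1<y_1$ (similarly $r<s$, $t<z$). A vertex $w$ resolves $\{x,y\}$ if $d(w,x)\neq d(w,y)$; $R(x,y)$ is the set of vertices resolving $\{x,y\}$. A set $S$ is a resolving set if every pair of vertices is resolved by some vertex of $S$. A pair $\{x,y\}$ is $S$-unique if $R(x,y)\cap S=\{u\}$ for a single vertex $u$, its associated vertex. Two diagonal pairs $\{x,y\},\{r,s\}$ with $d(x,y)=d(r,s)=2$ are in the same row if $x_2=r_2$ and $y_2=s_2$, and in the same column if $x_1=r_1$ and $y_1=s_1$. -}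

module Defs where

open import Data.Nat using (ℕ; _+_; _<_; ∣_-_∣)
open import Data.Fin using (Fin; toℕ)
open import Data.Product using (_×_; _,_; proj₁; proj₂; ∃-syntax)
open import Relation.Binary.PropositionalEquality using (_≡_; _≢_)

Vertex : ℕ → Set
Vertex ℓ = Fin ℓ × Fin ℓ

c₁ c₂ : ∀ {ℓ} → Vertex ℓ → ℕ
c₁ x = toℕ (proj₁ x)
c₂ x = toℕ (proj₂ x)

-- graph distance in the grid (Manhattan distance)
dist : ∀ {ℓ} → Vertex ℓ → Vertex ℓ → ℕ
dist x y = ∣ c₁ x - c₁ y ∣ + ∣ c₂ x - c₂ y ∣

Resolves : ∀ {ℓ} → Vertex ℓ → Vertex ℓ → Vertex ℓ → Set
Resolves w x y = dist w x ≢ dist w y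

Resolving : ∀ {ℓ} → (Vertex ℓ → Set) → Set
Resolving {ℓ} S = (a b : Vertex ℓ) → a ≢ b → ∃[ w ] (S w × Resolves w a b)

SUnique : ∀ {ℓ} → (Vertex ℓ → Set) → Vertex ℓ → Vertex ℓ → Vertex ℓ → Set
SUnique {ℓ} S x y u =
  (S u × Resolves u x y) × ((w : Vertex ℓ) → S w → Resolves w x y → w ≡ u)

-- {x,y} is a diagonal pair, named so that x < y (x₁ < y₁):
-- x, y ∈ D_i with 0 ≤ i ≤ ℓ-1
DiagPair : ∀ {ℓ} → Vertex ℓ → Vertex ℓ → Set
DiagPair {ℓ} x y = (c₁ x < c₁ y) × (c₁ x + c₂ x ≡ c₁ y + c₂ y) × (c₁ x + c₂ x < ℓ)

SameRow : ∀ {ℓ} → Vertex ℓ → Vertex ℓ → Vertex ℓ → Vertex ℓ → Set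
SameRow x y r s = (c₂ x ≡ c₂ r) × (c₂ y ≡ c₂ s)

SameCol : ∀ {ℓ} → Vertex ℓ → Vertex ℓ → Vertex ℓ → Vertex ℓ → Set
SameCol x y r s = (c₁ x ≡ c₁ r) × (c₁ y ≡ c₁ s)

module Submission where

-- A diagonal pair {x,y} with d(x,y) = 2 has the form x = (a, b+1), y = (a+1, b).
-- A vertex (i,j) resolves it exactly when it lies in the "north-west" quadrant
-- (i ≤ a, j > b) or the "south-east" quadrant (i > a, j ≤ b) of the pair; we call
-- this predicate 'Splits a b'.  For fixed b the quadrant predicate is convex in a:
-- a vertex splitting the pair at a = q also splits the pair at every p ≤ q or at
-- every m ≥ q; symmetrically in b for fixed a.  Pairs in the same row share b and
-- differ in a; pairs in the same column share a and differ in b.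
--
-- The theorem is then an instance of an abstract three-point argument: for a
-- convex family P of vertex predicates indexed by ℕ, if three indices each have a
-- unique S-vertex satisfying P, the associated vertex of the middle index agrees
-- with that of one of the outer indices.

open import Defs
open import Data.Nat using (ℕ; zero; suc; _+_; _≤_; _<_; ∣_-_∣; z≤n; s≤s; z<s)
open import Data.Nat.Properties
  using (≤-total; ≤-trans; <-≤-trans; ≰⇒>; _≤?_; +-suc; +-comm; suc-injective;
         ∣-∣-comm; ∣m-m+n∣≡n; ∣-∣-identityʳ; <⇒≢; m<n+m; 1+n≢0)
open import Data.Product using (_×_; _,_)
open import Data.Sum using (_⊎_; inj₁; inj₂; [_,_]′)
open import Function using (id)
open import Data.Empty using (⊥-elim)
open import Function.Bundles using (_⇔_; mk⇔; Equivalence)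
open import Relation.Nullary using (yes; no)
open import Relation.Binary.PropositionalEquality
  using (_≡_; _≢_; refl; sym; trans; cong; cong₂; module ≡-Reasoning)

module ThreePoint {V : Set} (S : V → Set) where

  UniqueIn : (V → Set) → V → Set
  UniqueIn P u = (S u × P u) × ((w : V) → S w → P w → w ≡ u)

  uniqueIn-⇔ : ∀ {P Q : V → Set} {u} → (∀ w → P w ⇔ Q w) → UniqueIn P u → UniqueIn Q u
  uniqueIn-⇔ P⇔Q ((Su , Pu) , only) =
    (Su , Equivalence.to (P⇔Q _) Pu) , λ w Sw Qw → only w Sw (Equivalence.from (P⇔Q w) Qw)

  Between : ℕ → ℕ → ℕ → Set
  Between p q m = (p ≤ q × q ≤ m) ⊎ (m ≤ q × q ≤ p)

  median : ∀ a b c → Between a b c ⊎ (Between a c b ⊎ Between b a c)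
  median a b c with ≤-total a b | ≤-total b c | ≤-total a c
  ... | inj₁ ab | inj₁ bc | _      = inj₁ (inj₁ (ab , bc))
  ... | inj₁ ab | inj₂ cb | inj₁ ac = inj₂ (inj₁ (inj₁ (ac , cb)))
  ... | inj₁ ab | inj₂ cb | inj₂ ca = inj₂ (inj₂ (inj₂ (ca , ab)))
  ... | inj₂ ba | inj₁ bc | inj₁ ac = inj₂ (inj₂ (inj₁ (ba , ac)))
  ... | inj₂ ba | inj₁ bc | inj₂ ca = inj₂ (inj₁ (inj₂ (bc , ca)))
  ... | inj₂ ba | inj₂ cb | _      = inj₁ (inj₂ (cb , ba))

  Convex : (ℕ → V → Set) → Set
  Convex P = ∀ {p q m w} → p ≤ q → q ≤ m → P q w → P p w ⊎ P m w

  module _ {P : ℕ → V → Set} (convex : Convex P) where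

    middle : ∀ {p q m vp vq vm} → Between p q m →
      UniqueIn (P p) vp → UniqueIn (P q) vq → UniqueIn (P m) vm → vq ≡ vp ⊎ vq ≡ vm
    middle (inj₁ (pq , qm)) (_ , onlyP) ((Sq , Pq) , _) (_ , onlyM) with convex pq qm Pq
    ... | inj₁ Pp = inj₁ (onlyP _ Sq Pp)
    ... | inj₂ Pm = inj₂ (onlyM _ Sq Pm)
    middle (inj₂ (mq , qp)) (_ , onlyP) ((Sq , Pq) , _) (_ , onlyM) with convex mq qp Pq
    ... | inj₁ Pm = inj₂ (onlyM _ Sq Pm)
    ... | inj₂ Pp = inj₁ (onlyP _ Sq Pp)

    threePoint : ∀ {a b c u v w} →
      UniqueIn (P a) u → UniqueIn (P b) v → UniqueIn (P c) w → u ≢ v → u ≢ w → v ≡ w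
    threePoint {a} {b} {c} U V W u≢v u≢w with median a b c
    ... | inj₁ b-mid = [ (λ v≡u → ⊥-elim (u≢v (sym v≡u))) , id ]′ (middle b-mid U V W)
    ... | inj₂ (inj₁ c-mid) = [ (λ w≡u → ⊥-elim (u≢w (sym w≡u))) , sym ]′ (middle c-mid U W V)
    ... | inj₂ (inj₂ a-mid) = [ (λ u≡v → ⊥-elim (u≢v u≡v)) , (λ u≡w → ⊥-elim (u≢w u≡w)) ]′
                                (middle a-mid V U W)

-- (i,j) lies in the north-west or the south-east quadrant of the pair
-- {(a, b+1), (a+1, b)}.
Splits : ℕ → ℕ → ℕ → ℕ → Set
Splits a b i j = (i ≤ a × b < j) ⊎ (a < i × j ≤ b)

dist-step-away : ∀ {i a} → i ≤ a → ∣ i - suc a ∣ ≡ suc ∣ i - a ∣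
dist-step-away {zero}  z≤n     = refl
dist-step-away {suc i} (s≤s p) = dist-step-away p

dist-step-toward : ∀ {i a} → a < i → ∣ i - a ∣ ≡ suc ∣ i - suc a ∣
dist-step-toward {suc i} {zero}  _       = cong suc (sym (∣-∣-identityʳ i))
dist-step-toward {suc i} {suc a} (s≤s p) = dist-step-toward p

module _ {a b i j : ℕ} where
  open ≡-Reasoning

  equidistant-low : i ≤ a → j ≤ b → ∣ i - a ∣ + ∣ j - suc b ∣ ≡ ∣ i - suc a ∣ + ∣ j - b ∣
  equidistant-low i≤a j≤b = begin
    ∣ i - a ∣ + ∣ j - suc b ∣     ≡⟨ cong (∣ i - a ∣ +_) (dist-step-away j≤b) ⟩
    ∣ i - a ∣ + suc ∣ j - b ∣     ≡⟨ +-suc ∣ i - a ∣ ∣ j - b ∣ ⟩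
    suc ∣ i - a ∣ + ∣ j - b ∣     ≡⟨ cong (_+ ∣ j - b ∣) (sym (dist-step-away i≤a)) ⟩
    ∣ i - suc a ∣ + ∣ j - b ∣     ∎

  equidistant-high : a < i → b < j → ∣ i - a ∣ + ∣ j - suc b ∣ ≡ ∣ i - suc a ∣ + ∣ j - b ∣
  equidistant-high a<i b<j = begin
    ∣ i - a ∣ + ∣ j - suc b ∣         ≡⟨ cong (_+ ∣ j - suc b ∣) (dist-step-toward a<i) ⟩
    suc ∣ i - suc a ∣ + ∣ j - suc b ∣ ≡⟨ sym (+-suc ∣ i - suc a ∣ ∣ j - suc b ∣) ⟩
    ∣ i - suc a ∣ + suc ∣ j - suc b ∣ ≡⟨ cong (∣ i - suc a ∣ +_) (sym (dist-step-toward b<j)) ⟩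
    ∣ i - suc a ∣ + ∣ j - b ∣         ∎

  closer-to-upper : i ≤ a → b < j → ∣ i - suc a ∣ + ∣ j - b ∣ ≡ 2 + (∣ i - a ∣ + ∣ j - suc b ∣)
  closer-to-upper i≤a b<j = begin
    ∣ i - suc a ∣ + ∣ j - b ∣         ≡⟨ cong₂ _+_ (dist-step-away i≤a) (dist-step-toward b<j) ⟩
    suc ∣ i - a ∣ + suc ∣ j - suc b ∣ ≡⟨ cong suc (+-suc ∣ i - a ∣ ∣ j - suc b ∣) ⟩
    2 + (∣ i - a ∣ + ∣ j - suc b ∣)   ∎

  closer-to-lower : a < i → j ≤ b → ∣ i - a ∣ + ∣ j - suc b ∣ ≡ 2 + (∣ i - suc a ∣ + ∣ j - b ∣)
  closer-to-lower a<i j≤b = begin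
    ∣ i - a ∣ + ∣ j - suc b ∣         ≡⟨ cong₂ _+_ (dist-step-toward a<i) (dist-step-away j≤b) ⟩
    suc ∣ i - suc a ∣ + suc ∣ j - b ∣ ≡⟨ cong suc (+-suc ∣ i - suc a ∣ ∣ j - b ∣) ⟩
    2 + (∣ i - suc a ∣ + ∣ j - b ∣)   ∎

n≢2+n : ∀ n → n ≢ 2 + n
n≢2+n n = <⇒≢ (m<n+m n z<s)

resolves⇔splits : ∀ a b i j →
  (∣ i - a ∣ + ∣ j - suc b ∣ ≢ ∣ i - suc a ∣ + ∣ j - b ∣) ⇔ Splits a b i j
resolves⇔splits a b i j = mk⇔ resolves⇒splits splits⇒resolves
  where
  resolves⇒splits : ∣ i - a ∣ + ∣ j - suc b ∣ ≢ ∣ i - suc a ∣ + ∣ j - b ∣ → Splits a b i j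
  resolves⇒splits res with i ≤? a | j ≤? b
  ... | yes i≤a | yes j≤b = ⊥-elim (res (equidistant-low i≤a j≤b))
  ... | yes i≤a | no  j≰b = inj₁ (i≤a , ≰⇒> j≰b)
  ... | no  i≰a | yes j≤b = inj₂ (≰⇒> i≰a , j≤b)
  ... | no  i≰a | no  j≰b = ⊥-elim (res (equidistant-high (≰⇒> i≰a) (≰⇒> j≰b)))

  splits⇒resolves : Splits a b i j → ∣ i - a ∣ + ∣ j - suc b ∣ ≢ ∣ i - suc a ∣ + ∣ j - b ∣
  splits⇒resolves (inj₁ (i≤a , b<j)) eq = n≢2+n _ (trans eq (closer-to-upper i≤a b<j))
  splits⇒resolves (inj₂ (a<i , j≤b)) eq = n≢2+n _ (trans (sym eq) (closer-to-lower a<i j≤b))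

-- Convexity of the quadrant predicate along a row (b fixed, a varying): the
-- north-west quadrant grows with a and the south-east quadrant shrinks.
splits-convex-row : ∀ {b i j p q m} → p ≤ q → q ≤ m →
  Splits q b i j → Splits p b i j ⊎ Splits m b i j
splits-convex-row p≤q q≤m (inj₁ (i≤q , b<j)) = inj₂ (inj₁ (≤-trans i≤q q≤m , b<j))
splits-convex-row p≤q q≤m (inj₂ (q<i , j≤b)) = inj₁ (inj₂ (<-≤-trans (s≤s p≤q) q<i , j≤b))

splits-convex-col : ∀ {a i j p q m} → p ≤ q → q ≤ m →
  Splits a q i j → Splits a p i j ⊎ Splits a m i j
splits-convex-col p≤q q≤m (inj₁ (i≤a , q<j)) = inj₁ (inj₁ (i≤a , <-≤-trans (s≤s p≤q) q<j))
splits-convex-col p≤q q≤m (inj₂ (a<i , j≤q)) = inj₂ (inj₂ (a<i , ≤-trans j≤q q≤m))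

∣k+y-y∣≡k : ∀ k y → ∣ k + y - y ∣ ≡ k
∣k+y-y∣≡k k y = trans (∣-∣-comm (k + y) y) (trans (cong (∣ y -_∣) (+-comm k y)) (∣m-m+n∣≡n y k))

unit-diagonal : ∀ x₁ x₂ y₁ y₂ → x₁ < y₁ → x₁ + x₂ ≡ y₁ + y₂ → ∣ x₁ - y₁ ∣ + ∣ x₂ - y₂ ∣ ≡ 2 →
  y₁ ≡ suc x₁ × x₂ ≡ suc y₂
unit-diagonal (suc x₁) x₂ (suc y₁) y₂ (s≤s x₁<y₁) sum d
  with unit-diagonal x₁ x₂ y₁ y₂ x₁<y₁ (suc-injective sum) d
... | y₁≡ , x₂≡ = cong suc y₁≡ , x₂≡
unit-diagonal zero x₂ (suc k) y₂ _ sum d = offset k sum d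
  where
  -- With x = (0, k + 1 + y₂) and y = (k + 1, y₂) the distance is 2(k+1).
  offset : ∀ k → x₂ ≡ suc k + y₂ → suc k + ∣ x₂ - y₂ ∣ ≡ 2 → suc k ≡ 1 × x₂ ≡ suc y₂
  offset zero    refl _ = refl , refl
  offset (suc k) refl d =
    ⊥-elim (double≢2 k (trans (cong (2 + k +_) (sym (∣k+y-y∣≡k (2 + k) y₂))) d))
    where
    double≢2 : ∀ n → (2 + n) + (2 + n) ≢ 2
    double≢2 n eq = 1+n≢0 (trans (sym (+-suc n (suc n))) (suc-injective (suc-injective eq)))

open ThreePoint

PairSplits : ∀ {ℓ} → Vertex ℓ → Vertex ℓ → Vertex ℓ → Set
PairSplits x y w = Splits (c₁ x) (c₂ y) (c₁ w) (c₂ w)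

resolves⇔pairSplits : ∀ {ℓ} {x y : Vertex ℓ} → DiagPair x y → dist x y ≡ 2 →
  ∀ w → Resolves w x y ⇔ PairSplits x y w
resolves⇔pairSplits {x = x} {y} (x₁<y₁ , sum , _) d w
  with unit-diagonal (c₁ x) (c₂ x) (c₁ y) (c₂ y) x₁<y₁ sum d
... | y₁≡ , x₂≡ rewrite y₁≡ | x₂≡ = resolves⇔splits (c₁ x) (c₂ y) (c₁ w) (c₂ w)

uniqueSplitter : ∀ {ℓ} {S : Vertex ℓ → Set} {x y u : Vertex ℓ} →
  DiagPair x y → dist x y ≡ 2 → SUnique S x y u → UniqueIn S (PairSplits x y) u
uniqueSplitter {S = S} dp d = uniqueIn-⇔ S (resolves⇔pairSplits dp d)

-- Splitting {r,s} depends on s only through its row, so a pair in the same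
-- row as {x,y} is split exactly as {r,y} is.
uniqueSplitter-row : ∀ {ℓ} {S : Vertex ℓ → Set} (x y r s : Vertex ℓ) {v : Vertex ℓ} →
  SameRow x y r s → UniqueIn S (PairSplits r s) v → UniqueIn S (PairSplits r y) v
uniqueSplitter-row _ _ _ _ (_ , y₂≡s₂) V rewrite y₂≡s₂ = V

uniqueSplitter-col : ∀ {ℓ} {S : Vertex ℓ → Set} (x y r s : Vertex ℓ) {v : Vertex ℓ} →
  SameCol x y r s → UniqueIn S (PairSplits r s) v → UniqueIn S (PairSplits x s) v
uniqueSplitter-col _ _ _ _ (x₁≡r₁ , _) V rewrite x₁≡r₁ = V

lemma3p4 : (ℓ : ℕ) → 2 ≤ ℓ → (S : Vertex ℓ → Set) → Resolving S →
    (x y u : Vertex ℓ) → DiagPair x y → dist x y ≡ 2 → SUnique S x y u →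
    (r s v : Vertex ℓ) → DiagPair r s → dist r s ≡ 2 → SUnique S r s v →
    (t z w : Vertex ℓ) → DiagPair t z → dist t z ≡ 2 → SUnique S t z w →
    ((SameRow x y r s × SameRow x y t z) ⊎ (SameCol x y r s × SameCol x y t z)) →
    u ≢ v → u ≢ w → v ≡ w
lemma3p4 ℓ _ S _ x y u xy d-xy xy-u r s v rs d-rs rs-v t z w tz d-tz tz-w row-or-col u≢v u≢w
  with uniqueSplitter xy d-xy xy-u | uniqueSplitter rs d-rs rs-v | uniqueSplitter tz d-tz tz-w
... | U | V | W with row-or-col
...   | inj₁ (row-rs , row-tz) =
  threePoint S {P = λ a q → Splits a (c₂ y) (c₁ q) (c₂ q)} splits-convex-row
    U (uniqueSplitter-row x y r s row-rs V) (uniqueSplitter-row x y t z row-tz W) u≢v u≢w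
...   | inj₂ (col-rs , col-tz) =
  threePoint S {P = λ b q → Splits (c₁ x) b (c₁ q) (c₂ q)} splits-convex-col
    U (uniqueSplitter-col x y r s col-rs V) (uniqueSplitter-col x y t z col-tz W) u≢v u≢w
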